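{- Let $r,n\ge1$ be integers with $n\le r$. Then there exists an $r$-colouring of $\mathbb{F}_3^n\setminus\{0\}$ with no monochromatic Brauer quadruple, i.e. no $x,y$ such that $x,\ y,\ x+y,\ x+2y$ all lie in $\mathbb{F}_3^n\setminus\{0\}$ and all receive the same colour. -}

module Defs where

open import Data.Nat using (ℕ)
open import Data.Fin using (Fin; zero; suc)
open import Data.Vec using (Vec; replicate; zipWith)
open import Data.Product using (Σ; _×_; _,_; proj₁)
open import Relation.Binary.PropositionalEquality using (_≡_; _≢_)
open import Relation.Nullary using (¬_)

F₃ : Set
F₃ = Fin 3

_+₃_ : F₃ → F₃ → F₃
zero +₃ b = b
suc zero +₃ zero = suc zero
suc zero +₃ suc zero = suc (suc zero)
suc zero +₃ suc (suc zero) = zero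
suc (suc zero) +₃ zero = suc (suc zero)
suc (suc zero) +₃ suc zero = zero
suc (suc zero) +₃ suc (suc zero) = suc zero

F₃^ : ℕ → Set
F₃^ n = Vec F₃ n

0ᵥ : ∀ {n} → F₃^ n
0ᵥ = replicate _ zero

_⊕_ : ∀ {n} → F₃^ n → F₃^ n → F₃^ n
_⊕_ = zipWith _+₃_

Nonzero : ℕ → Set
Nonzero n = Σ (F₃^ n) (λ v → v ≢ 0ᵥ)

Colouring : ℕ → ℕ → Set
Colouring r n = Nonzero n → Fin r

MonoBrauer : ∀ {r n} → Colouring r n → Set
MonoBrauer {r} {n} c =
  Σ (Nonzero n) λ x → Σ (Nonzero n) λ y →
  Σ ((proj₁ x ⊕ proj₁ y) ≢ 0ᵥ) λ h₁ →
  Σ ((proj₁ x ⊕ (proj₁ y ⊕ proj₁ y)) ≢ 0ᵥ) λ h₂ →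
    (c y ≡ c x) × (c (_ , h₁) ≡ c x) × (c (_ , h₂) ≡ c x)

-- Colour a nonzero vector by the position of its first nonzero coordinate. If x, y, x + y and
-- x + 2y all had their first nonzero coordinate at the same position k, the k-th coordinates
-- a = x_k and b = y_k would satisfy a, b, a + b, a + 2b ≠ 0 in F₃; but for nonzero a, b
-- either b = -a (so a + b = 0) or b = a (so a + 2b = 3a = 0).
module Submission where

open import Defs
open import Data.Nat using (ℕ; _≤_; _≥_; _<_; suc; s≤s; z≤n)
open import Data.Nat.Properties using (≤-trans; suc-injective)
open import Data.Fin as Fin using (fromℕ<)
open import Data.Fin.Properties using (fromℕ<-injective)
open import Data.Vec using ([]; _∷_)
open import Data.Product using (Σ; _,_; proj₁; proj₂)
open import Data.Sum using (_⊎_; inj₁; inj₂; [_,_])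
open import Relation.Nullary using (¬_)
open import Relation.Binary.PropositionalEquality using (_≡_; _≢_; refl; cong)

+₃-nonzero-brauer : ∀ (a b : F₃) → a ≢ Fin.zero → b ≢ Fin.zero →
                    a +₃ b ≡ Fin.zero ⊎ a +₃ (b +₃ b) ≡ Fin.zero
+₃-nonzero-brauer Fin.zero _ a≢0 _ with () ← a≢0 refl
+₃-nonzero-brauer _ Fin.zero _ b≢0 with () ← b≢0 refl
+₃-nonzero-brauer (Fin.suc Fin.zero)            (Fin.suc Fin.zero)            _ _ = inj₂ refl
+₃-nonzero-brauer (Fin.suc Fin.zero)            (Fin.suc (Fin.suc Fin.zero))  _ _ = inj₁ refl
+₃-nonzero-brauer (Fin.suc (Fin.suc Fin.zero))  (Fin.suc Fin.zero)            _ _ = inj₁ refl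
+₃-nonzero-brauer (Fin.suc (Fin.suc Fin.zero))  (Fin.suc (Fin.suc Fin.zero))  _ _ = inj₂ refl

leadingZeros : ∀ {n} → F₃^ n → ℕ
leadingZeros []              = 0
leadingZeros (Fin.zero  ∷ v) = suc (leadingZeros v)
leadingZeros (Fin.suc _ ∷ _) = 0

leadingZeros<length : ∀ {n} (v : F₃^ n) → v ≢ 0ᵥ → leadingZeros v < n
leadingZeros<length []              v≢0 with () ← v≢0 refl
leadingZeros<length (Fin.zero  ∷ v) v≢0 = s≤s (leadingZeros<length v (λ v≡0 → v≢0 (cong (Fin.zero ∷_) v≡0)))
leadingZeros<length (Fin.suc _ ∷ _) _   = s≤s z≤n

leadingZeros-∷-zero : ∀ {n a} {v : F₃^ n} → a ≡ Fin.zero → leadingZeros (a ∷ v) ≢ 0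
leadingZeros-∷-zero refl ()

brauer-leadingZeros-not-all-equal : ∀ {n} (x y : F₃^ n) → x ≢ 0ᵥ →
  leadingZeros y ≡ leadingZeros x →
  leadingZeros (x ⊕ y) ≡ leadingZeros x →
  leadingZeros (x ⊕ (y ⊕ y)) ≢ leadingZeros x
brauer-leadingZeros-not-all-equal [] [] x≢0 _ _ _ = x≢0 refl
brauer-leadingZeros-not-all-equal (Fin.zero ∷ x) (Fin.zero ∷ y) x≢0 y≈x x+y≈x x+2y≈x =
  brauer-leadingZeros-not-all-equal x y (λ x≡0 → x≢0 (cong (Fin.zero ∷_) x≡0))
    (suc-injective y≈x) (suc-injective x+y≈x) (suc-injective x+2y≈x)
brauer-leadingZeros-not-all-equal (Fin.zero  ∷ _) (Fin.suc _ ∷ _) _ () _ _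
brauer-leadingZeros-not-all-equal (Fin.suc _ ∷ _) (Fin.zero  ∷ _) _ () _ _
brauer-leadingZeros-not-all-equal (Fin.suc i ∷ _) (Fin.suc j ∷ _) _ _ x+y≈x x+2y≈x =
  [ (λ a+b≡0 → leadingZeros-∷-zero a+b≡0 x+y≈x) , (λ a+2b≡0 → leadingZeros-∷-zero a+2b≡0 x+2y≈x) ]
    (+₃-nonzero-brauer (Fin.suc i) (Fin.suc j) (λ ()) (λ ()))

leadingZerosColouring : ∀ {r n} → n ≤ r → Colouring r n
leadingZerosColouring n≤r (v , v≢0) = fromℕ< (≤-trans (leadingZeros<length v v≢0) n≤r)

proposition1p4 : (r n : ℕ) → r ≥ 1 → n ≥ 1 → n ≤ r →
    Σ (Colouring r n) (λ c → ¬ MonoBrauer c)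
proposition1p4 r n _ _ n≤r = c , no-mono
  where
  c : Colouring r n
  c = leadingZerosColouring n≤r

  leadingZeros-of-colour : ∀ u w → c u ≡ c w → leadingZeros (proj₁ u) ≡ leadingZeros (proj₁ w)
  leadingZeros-of-colour _ _ = fromℕ<-injective _ _ _ _

  no-mono : ¬ MonoBrauer c
  no-mono (x , y , x+y≢0 , x+2y≢0 , cy≡cx , cx+y≡cx , cx+2y≡cx) =
    brauer-leadingZeros-not-all-equal (proj₁ x) (proj₁ y) (proj₂ x)
      (leadingZeros-of-colour y x cy≡cx)
      (leadingZeros-of-colour (_ , x+y≢0) x cx+y≡cx)
      (leadingZeros-of-colour (_ , x+2y≢0) x cx+2y≡cx)
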